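{- For $i\ge 1$ let $r_i$ denote the $i$-th smallest prime number greater than $3$ (so $r_1=5$, $r_2=7$, $r_3=11,\dots$). Let $t$ be an integer. Then: (i) if $t\ge 16$, $r_7r_8\cdots r_t>((t+3)2^{t-3})^3$; (ii) if $t\ge 7$, $r_3r_4\cdots r_t>45\cdot 49\cdot (t+3)2^{t-3}$; (iii) if $t\ge 5$, $r_3r_4\cdots r_t>2\cdot 18\cdot (t+3)2^{t-3}$; (iv) if $t\ge 18$, $r_7r_8\cdots r_t>(3(t+3)2^{t-3}-1)^3$; (v) if $t\ge 9$, $r_3r_4\cdots r_t>142\cdot 304\cdot (3(t+3)2^{t-3}-1)$; (vi) if $t\ge 8$, $r_3r_4\cdots r_t>49\cdot 142\cdot (3(t+3)2^{t-3}-1)$; (vii) if $t\ge 7$, $r_3r_4\cdots r_t>9\cdot 88\cdot (3(t+3)2^{t-3}-1)$; (viii) if $t\ge 18$, $r_7r_8\cdots r_t>(4(t+3)2^{t-3}-1)^3$; (ix) if $t\ge 9$, $r_3r_4\cdots r_t>190\cdot 294\cdot (4(t+3)2^{t-3}-1)$; (x) if $t\ge 8$, $r_3r_4\cdots r_t>66\cdot 110\cdot (4(t+3)2^{t-3}-1)$; (xi) if $t\ge 7$, $r_3r_4\cdots r_t>3\cdot 90\cdot (4(t+3)2^{t-3}-1)$; (xii) if $t\ge 20$, $r_7r_8\cdots r_t>(12(t+3)2^{t-3}-7)^3$; (xiii) if $t\ge 10$, $r_3r_4\cdots r_t>580\cdot 1492\cdot (12(t+3)2^{t-3}-7)$. 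-}

module Defs where

open import Data.Nat using (ℕ; zero; suc; _+_; _*_; _∸_; _^_; _≤_; _<_)
open import Data.Nat.Primality using (Prime)
open import Data.Product using (∃; _×_)
open import Relation.Binary.PropositionalEquality using (_≡_)

-- r enumerates the primes greater than 3 in increasing order, indexed from 1:
-- r 1 = 5, r 2 = 7, r 3 = 11, ...  (the value r 0 is unconstrained/irrelevant).
-- These conditions determine r i uniquely for every i ≥ 1.
record PrimesAbove3Enum (r : ℕ → ℕ) : Set where
  field
    prime  : ∀ i → 1 ≤ i → Prime (r i)
    above3 : ∀ i → 1 ≤ i → 3 < r i
    strict : ∀ i j → 1 ≤ i → i < j → r i < r j
    onto   : ∀ p → Prime p → 3 < p → ∃ λ i → 1 ≤ i × r i ≡ p

prodFrom : (ℕ → ℕ) → ℕ → ℕ → ℕ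
prodFrom r a zero    = 1
prodFrom r a (suc n) = r a * prodFrom r (suc a) n

-- ∏_{i=a}^{t} r i  (empty product = 1 when t < a)
prodRange : (ℕ → ℕ) → ℕ → ℕ → ℕ
prodRange r a t = prodFrom r a (suc t ∸ a)

-- B t = (t+3) 2^(t-3), used for t ≥ 5 only (so t ∸ 3 is exact)
B : ℕ → ℕ
B t = (t + 3) * 2 ^ (t ∸ 3)

{-# OPTIONS --safe #-}
-- Since B (t + 1) ≤ 3 B t, a bound of the form c · B t at most triples from t to t + 1 and its
-- cube grows at most 27-fold, whereas the product gains the factor r (t + 1), which is ≥ 5, and
-- ≥ 29 once t + 1 ≥ 8. Each inequality therefore propagates from its least admissible t, where
-- it is checked by evaluation after bounding r i below by the i-th prime above 3 (r is strictly
-- increasing and hits only primes).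
module Submission where

open import Defs
open import Data.Nat using (ℕ; zero; suc; _+_; _*_; _∸_; _^_; _≤_; _<_; _>_; _≤′_; ≤′-refl; ≤′-step; s≤s; z<s; NonZero)
open import Data.Nat.Properties
open import Data.Nat.Primality using (Prime; prime?)
open import Data.Nat.Tactic.RingSolver using (solve-∀)
open import Data.Product using (_×_; _,_)
open import Data.Sum using (inj₁; inj₂)
open import Function using (_∘_)
open import Relation.Nullary using (yes; no)
open import Relation.Binary.PropositionalEquality using (_≡_; refl; cong; module ≡-Reasoning)

-- Exhausting the search returns m + k, so the result is a lower bound for every prime ≥ m
-- whatever the search length.
searchPrime : ℕ → ℕ → ℕ
searchPrime m zero = m
searchPrime m (suc k) with prime? m
... | yes _ = m
... | no _  = searchPrime (suc m) k

searchPrime-≤ : ∀ m k {p} → Prime p → m ≤ p → searchPrime m k ≤ p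
searchPrime-≤ m zero    _  m≤p = m≤p
searchPrime-≤ m (suc k) pp m≤p with prime? m
... | yes _  = m≤p
... | no ¬pm = searchPrime-≤ (suc m) k pp (≤∧≢⇒< m≤p λ { refl → ¬pm pp })

-- Consecutive primes below 80 differ by at most 6, so primeBound i is exactly the i-th prime
-- above 3 for 1 ≤ i ≤ 20, which is as far as the base cases need.
primeBound : ℕ → ℕ
primeBound zero    = 3
primeBound (suc i) = searchPrime (suc (primeBound i)) 6

prodFrom-suc : ∀ f a n → prodFrom f a (suc n) ≡ prodFrom f a n * f (a + n)
prodFrom-suc f a zero = begin
  f a * 1        ≡⟨ *-identityʳ (f a) ⟩
  f a            ≡⟨ cong f (+-identityʳ a) ⟨
  f (a + 0)      ≡⟨ *-identityˡ (f (a + 0)) ⟨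
  1 * f (a + 0)  ∎
  where open ≡-Reasoning
prodFrom-suc f a (suc n) = begin
  f a * prodFrom f (suc a) (suc n)              ≡⟨ cong (f a *_) (prodFrom-suc f (suc a) n) ⟩
  f a * (prodFrom f (suc a) n * f (suc a + n))  ≡⟨ *-assoc (f a) _ _ ⟨
  f a * prodFrom f (suc a) n * f (suc a + n)    ≡⟨ cong (λ i → f a * prodFrom f (suc a) n * f i) (+-suc a n) ⟨
  f a * prodFrom f (suc a) n * f (a + suc n)    ∎
  where open ≡-Reasoning

prodRange-suc : ∀ f {a t} → a ≤ t → prodRange f a (suc t) ≡ prodRange f a t * f (suc t)
prodRange-suc f {a} {t} a≤t = begin
  prodFrom f a (suc (suc t) ∸ a)            ≡⟨ cong (prodFrom f a) (+-∸-assoc 1 a≤1+t) ⟩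
  prodFrom f a (suc (suc t ∸ a))            ≡⟨ prodFrom-suc f a (suc t ∸ a) ⟩
  prodRange f a t * f (a + (suc t ∸ a))     ≡⟨ cong (λ i → prodRange f a t * f i) (m+[n∸m]≡n a≤1+t) ⟩
  prodRange f a t * f (suc t)               ∎
  where
    open ≡-Reasoning
    a≤1+t : a ≤ suc t
    a≤1+t = m≤n⇒m≤1+n a≤t

prodFrom-mono-≤ : ∀ {f g} a n → (∀ i → a ≤ i → f i ≤ g i) → prodFrom f a n ≤ prodFrom g a n
prodFrom-mono-≤ a zero    f≤g = ≤-refl
prodFrom-mono-≤ a (suc n) f≤g =
  *-mono-≤ (f≤g a ≤-refl) (prodFrom-mono-≤ (suc a) n λ i a<i → f≤g i (<⇒≤ a<i))

record GrowsAtMost (m : ℕ) (F : ℕ → ℕ) : Set where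
  field step : ∀ t → F (suc t) ≤ m * F t
open GrowsAtMost

*-growsAtMost : ∀ {m F} c → GrowsAtMost m F → GrowsAtMost m (λ t → c * F t)
*-growsAtMost {m} {F} c grows .step t = begin
  c * F (suc t)  ≤⟨ *-monoʳ-≤ c (grows .step t) ⟩
  c * (m * F t)  ≡⟨ *-assoc c m (F t) ⟨
  c * m * F t    ≡⟨ cong (_* F t) (*-comm c m) ⟩
  m * c * F t    ≡⟨ *-assoc m c (F t) ⟩
  m * (c * F t)  ∎
  where open ≤-Reasoning

^-distribʳ-* : ∀ m n k → (m * n) ^ k ≡ m ^ k * n ^ k
^-distribʳ-* m n zero    = refl
^-distribʳ-* m n (suc k) = begin
  m * n * (m * n) ^ k        ≡⟨ cong (m * n *_) (^-distribʳ-* m n k) ⟩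
  m * n * (m ^ k * n ^ k)    ≡⟨ [m*n]*[o*p]≡[m*o]*[n*p] m n (m ^ k) (n ^ k) ⟩
  m * m ^ k * (n * n ^ k)    ∎
  where open ≡-Reasoning

^-growsAtMost : ∀ {m F} k → GrowsAtMost m F → GrowsAtMost (m ^ k) (λ t → F t ^ k)
^-growsAtMost {m} {F} k grows .step t = begin
  F (suc t) ^ k    ≤⟨ ^-monoˡ-≤ k (grows .step t) ⟩
  (m * F t) ^ k    ≡⟨ ^-distribʳ-* m (F t) k ⟩
  m ^ k * F t ^ k  ∎
  where open ≤-Reasoning

B-growsAtMost : GrowsAtMost 3 B
B-growsAtMost .step zero             = ≤ᵇ⇒≤ _ _ _
B-growsAtMost .step (suc zero)       = ≤ᵇ⇒≤ _ _ _
B-growsAtMost .step (suc (suc zero)) = ≤ᵇ⇒≤ _ _ _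
B-growsAtMost .step (suc (suc (suc s))) = begin
  B (4 + s)                        ≤⟨ m≤m+n (B (4 + s)) ((4 + s) * 2 ^ s) ⟩
  B (4 + s) + (4 + s) * 2 ^ s      ≡⟨ rearrange s (2 ^ s) ⟩
  3 * B (3 + s)                    ∎
  where
    open ≤-Reasoning
    rearrange : ∀ s x → (4 + s + 3) * (2 * x) + (4 + s) * x ≡ 3 * ((3 + s + 3) * x)
    rearrange = solve-∀

prodRange-outgrows : ∀ {f F m a t₀} .{{_ : NonZero m}} → GrowsAtMost m F →
                     (∀ t → t₀ ≤ t → m ≤ f (suc t)) → a ≤ t₀ →
                     F t₀ < prodRange f a t₀ → ∀ t → t₀ ≤ t → F t < prodRange f a t
prodRange-outgrows {f} {F} {m} {a} {t₀} grows m≤f a≤t₀ base _ = go ∘ ≤⇒≤′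
  where
    go : ∀ {t} → t₀ ≤′ t → F t < prodRange f a t
    go ≤′-refl = base
    go {suc t} (≤′-step t₀≤′t) = begin-strict
      F (suc t)                   ≤⟨ grows .step t ⟩
      m * F t                     <⟨ *-monoʳ-< m (go t₀≤′t) ⟩
      m * prodRange f a t         ≤⟨ *-monoˡ-≤ _ (m≤f t t₀≤t) ⟩
      f (suc t) * prodRange f a t ≡⟨ *-comm (f (suc t)) _ ⟩
      prodRange f a t * f (suc t) ≡⟨ prodRange-suc f (≤-trans a≤t₀ t₀≤t) ⟨
      prodRange f a (suc t)       ∎
      where
        open ≤-Reasoning
        t₀≤t : t₀ ≤ t
        t₀≤t = ≤′⇒≤ t₀≤′t

module EnumerationBounds {r : ℕ → ℕ} (E : PrimesAbove3Enum r) where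
  open PrimesAbove3Enum E

  r-mono-≤ : ∀ {i j} → 1 ≤ i → i ≤ j → r i ≤ r j
  r-mono-≤ 1≤i i≤j with m≤n⇒m<n∨m≡n i≤j
  ... | inj₁ i<j  = <⇒≤ (strict _ _ 1≤i i<j)
  ... | inj₂ refl = ≤-refl

  primeBound≤r : ∀ i → 1 ≤ i → primeBound i ≤ r i
  primeBound<r-suc : ∀ i → primeBound i < r (suc i)

  primeBound≤r (suc i) _ = searchPrime-≤ _ 6 (prime (suc i) z<s) (primeBound<r-suc i)

  primeBound<r-suc zero    = above3 1 z<s
  primeBound<r-suc (suc i) = ≤-<-trans (primeBound≤r (suc i) z<s) (strict _ _ z<s (n<1+n _))

  prodRange-primeBound-≤ : ∀ a t → 1 ≤ a → prodRange primeBound a t ≤ prodRange r a t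
  prodRange-primeBound-≤ a t 1≤a =
    prodFrom-mono-≤ a (suc t ∸ a) λ i a≤i → primeBound≤r i (≤-trans 1≤a a≤i)

  3≤r : ∀ i → 3 ≤ r (suc i)
  3≤r i = <⇒≤ (above3 (suc i) z<s)

  27≤r : ∀ i → 8 ≤ i → 27 ≤ r i
  27≤r i 8≤i = begin
    27            ≤⟨ ≤ᵇ⇒≤ 27 (primeBound 8) _ ⟩
    primeBound 8  ≤⟨ primeBound≤r 8 z<s ⟩
    r 8           ≤⟨ r-mono-≤ z<s 8≤i ⟩
    r i           ∎
    where open ≤-Reasoning

  linear-bound : ∀ {F} → GrowsAtMost 3 F → ∀ c j t₀ → 3 ≤ t₀ →
                 c * F t₀ < prodRange primeBound 3 t₀ →
                 ∀ t → t₀ ≤ t → c * (F t ∸ j) < prodRange r 3 t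
  linear-bound {F} grows c j t₀ 3≤t₀ base t t₀≤t =
    ≤-<-trans (*-monoʳ-≤ c (m∸n≤m (F t) j))
              (prodRange-outgrows (*-growsAtMost c grows) (λ t _ → 3≤r t) 3≤t₀
                                  (<-≤-trans base (prodRange-primeBound-≤ 3 t₀ z<s)) t t₀≤t)

  cubic-bound : ∀ {F} → GrowsAtMost 3 F → ∀ j t₀ → 7 ≤ t₀ →
                F t₀ ^ 3 < prodRange primeBound 7 t₀ →
                ∀ t → t₀ ≤ t → (F t ∸ j) ^ 3 < prodRange r 7 t
  cubic-bound {F} grows j t₀ 7≤t₀ base t t₀≤t =
    ≤-<-trans (^-monoˡ-≤ 3 (m∸n≤m (F t) j))
              (prodRange-outgrows (^-growsAtMost 3 grows)
                                  (λ t t₀≤t → 27≤r (suc t) (s≤s (≤-trans 7≤t₀ t₀≤t))) 7≤t₀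
                                  (<-≤-trans base (prodRange-primeBound-≤ 7 t₀ z<s)) t t₀≤t)

proposition2p6 : (r : ℕ → ℕ) → PrimesAbove3Enum r →
    (∀ t → 16 ≤ t → prodRange r 7 t > (B t) ^ 3) ×
    (∀ t → 7 ≤ t → prodRange r 3 t > 45 * 49 * B t) ×
    (∀ t → 5 ≤ t → prodRange r 3 t > 2 * 18 * B t) ×
    (∀ t → 18 ≤ t → prodRange r 7 t > (3 * B t ∸ 1) ^ 3) ×
    (∀ t → 9 ≤ t → prodRange r 3 t > 142 * 304 * (3 * B t ∸ 1)) ×
    (∀ t → 8 ≤ t → prodRange r 3 t > 49 * 142 * (3 * B t ∸ 1)) ×
    (∀ t → 7 ≤ t → prodRange r 3 t > 9 * 88 * (3 * B t ∸ 1)) ×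
    (∀ t → 18 ≤ t → prodRange r 7 t > (4 * B t ∸ 1) ^ 3) ×
    (∀ t → 9 ≤ t → prodRange r 3 t > 190 * 294 * (4 * B t ∸ 1)) ×
    (∀ t → 8 ≤ t → prodRange r 3 t > 66 * 110 * (4 * B t ∸ 1)) ×
    (∀ t → 7 ≤ t → prodRange r 3 t > 3 * 90 * (4 * B t ∸ 1)) ×
    (∀ t → 20 ≤ t → prodRange r 7 t > (12 * B t ∸ 7) ^ 3) ×
    (∀ t → 10 ≤ t → prodRange r 3 t > 580 * 1492 * (12 * B t ∸ 7))
proposition2p6 r E =
    cubic-bound  B-growsAtMost                      0 16  (≤ᵇ⇒≤ _ _ _) (≤ᵇ⇒≤ _ _ _)
  , linear-bound B-growsAtMost      (45 * 49)       0 7   (≤ᵇ⇒≤ _ _ _) (≤ᵇ⇒≤ _ _ _)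
  , linear-bound B-growsAtMost      (2 * 18)        0 5   (≤ᵇ⇒≤ _ _ _) (≤ᵇ⇒≤ _ _ _)
  , cubic-bound  (kB-growsAtMost 3)                 1 18  (≤ᵇ⇒≤ _ _ _) (≤ᵇ⇒≤ _ _ _)
  , linear-bound (kB-growsAtMost 3) (142 * 304)     1 9   (≤ᵇ⇒≤ _ _ _) (≤ᵇ⇒≤ _ _ _)
  , linear-bound (kB-growsAtMost 3) (49 * 142)      1 8   (≤ᵇ⇒≤ _ _ _) (≤ᵇ⇒≤ _ _ _)
  , linear-bound (kB-growsAtMost 3) (9 * 88)        1 7   (≤ᵇ⇒≤ _ _ _) (≤ᵇ⇒≤ _ _ _)
  , cubic-bound  (kB-growsAtMost 4)                 1 18  (≤ᵇ⇒≤ _ _ _) (≤ᵇ⇒≤ _ _ _)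
  , linear-bound (kB-growsAtMost 4) (190 * 294)     1 9   (≤ᵇ⇒≤ _ _ _) (≤ᵇ⇒≤ _ _ _)
  , linear-bound (kB-growsAtMost 4) (66 * 110)      1 8   (≤ᵇ⇒≤ _ _ _) (≤ᵇ⇒≤ _ _ _)
  , linear-bound (kB-growsAtMost 4) (3 * 90)        1 7   (≤ᵇ⇒≤ _ _ _) (≤ᵇ⇒≤ _ _ _)
  , cubic-bound  (kB-growsAtMost 12)                7 20  (≤ᵇ⇒≤ _ _ _) (≤ᵇ⇒≤ _ _ _)
  , linear-bound (kB-growsAtMost 12) (580 * 1492)   7 10  (≤ᵇ⇒≤ _ _ _) (≤ᵇ⇒≤ _ _ _)
  where
    open EnumerationBounds E
    kB-growsAtMost : ∀ k → GrowsAtMost 3 (λ t → k * B t)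
    kB-growsAtMost k = *-growsAtMost k B-growsAtMost
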